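{- Let $M$ be a nonnegative matrix with rows indexed by $\{1,\dots,m\}$ and columns indexed by a set $S$, and let $S=S_1\cup\dots\cup S_m$ be a partition of $S$ into non-empty subsets. Suppose that $M_{j,s}>0$ for each $j\in\{1,\dots,m\}$ and each $s\in S\setminus S_j$. Suppose further that for each $j\in\{1,\dots,m\}$, each $k\in\{1,\dots,j-1\}$, each $s\in S_j$ and each $t\in S_1\cup\dots\cup S_{j-1}$, we have $M_{j,s}M_{k,t}\leq M_{j,t}M_{k,s}$. Then there exist positive real numbers $\alpha_1,\dots,\alpha_m$ such that $\alpha_jM_{j,s}\leq\alpha_kM_{k,s}$ whenever $j,k\in\{1,\dots,m\}$ and $s\in S_j$. -}

module Defs where

open import Level using (Level; _⊔_; suc)
open import Algebra.Bundles using (CommutativeRing)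
open import Relation.Binary.Structures using (IsStrictTotalOrder)
open import Relation.Binary.Core using (Rel)
open import Relation.Nullary using (¬_)
open import Data.Product using (∃)
open import Data.Sum using (_⊎_)
open import Data.Nat using (ℕ)
open import Data.Fin using (Fin)
import Data.Fin as F
open import Relation.Binary.PropositionalEquality using (_≡_; _≢_)

record OrderedField (c ℓ₁ ℓ₂ : Level) : Set (suc (c ⊔ ℓ₁ ⊔ ℓ₂)) where
  field
    commutativeRing : CommutativeRing c ℓ₁
  open CommutativeRing commutativeRing public
  field
    _<_                 : Rel Carrier ℓ₂
    isStrictTotalOrder  : IsStrictTotalOrder _≈_ _<_
    nontrivial          : ¬ (0# ≈ 1#)
    inverse             : ∀ x → ¬ (x ≈ 0#) → ∃ λ y → x * y ≈ 1#
    +-mono-<            : ∀ x y z → x < y → (x + z) < (y + z)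
    *-pos               : ∀ x y → 0# < x → 0# < y → 0# < (x * y)

  _≤_ : Rel Carrier (ℓ₁ ⊔ ℓ₂)
  x ≤ y = (x < y) ⊎ (x ≈ y)

-- Hypotheses of Lemma 10.3, for an m × n matrix M over an ordered field F,
-- whose column set S = Fin n is partitioned into S_1,…,S_m by `part`
-- (column s lies in S_{part s}).
module _ {c ℓ₁ ℓ₂} (F : OrderedField c ℓ₁ ℓ₂) where
  open OrderedField F

  Nonneg : ∀ {m n} → (Fin m → Fin n → Carrier) → Set (ℓ₁ ⊔ ℓ₂)
  Nonneg M = ∀ j s → 0# ≤ M j s

  BlocksNonempty : ∀ {m n} → (Fin n → Fin m) → Set
  BlocksNonempty {m} {n} part = ∀ (j : Fin m) → ∃ λ (s : Fin n) → part s ≡ j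

  PosOffBlock : ∀ {m n} → (Fin m → Fin n → Carrier) → (Fin n → Fin m) → Set ℓ₂
  PosOffBlock M part = ∀ j s → part s ≢ j → 0# < M j s

  CrossIneq : ∀ {m n} → (Fin m → Fin n → Carrier) → (Fin n → Fin m) → Set (ℓ₁ ⊔ ℓ₂)
  CrossIneq M part = ∀ j k s t → k F.< j → part s ≡ j → part t F.< j →
                     (M j s * M k t) ≤ (M j t * M k s)

-- The scalars α_1, …, α_m are chosen one row at a time.  Suppose α is already
-- a valid scaling on the rows k < q.  The conditions involving row q and an
-- earlier row k say exactly that α_q lies between
--   lower bounds  α_k M_{k,t} / M_{q,t}   (t ∈ S_k), and
--   upper bounds  α_k M_{k,s} / M_{q,s}   (s ∈ S_q, M_{q,s} > 0),
-- (an entry M_{q,s} = 0 imposes nothing).  The cross inequality, together with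
-- the validity of α on the earlier rows, shows that every lower bound is below
-- every upper bound, and between finitely many such bounds there is always a
-- positive value.
module Submission where

open import Defs
open import Level using (_⊔_)
open import Data.Nat using (ℕ; zero; suc; s≤s⁻¹)
import Data.Nat as ℕ
import Data.Nat.Properties as ℕ
open import Data.Fin using (Fin; toℕ; fromℕ<; _≟_)
open import Data.Fin.Properties using (toℕ<n; toℕ-fromℕ<; toℕ-injective)
open import Data.Vec.Functional using (updateAt)
open import Data.Vec.Functional.Properties using (updateAt-updates; updateAt-minimal)
open import Data.Product using (∃; _×_; _,_; proj₁; proj₂)
open import Data.Sum using (inj₁; inj₂)
open import Data.Empty using (⊥-elim)
open import Data.List using (List; map; filter; cartesianProduct; allFin)
open import Data.List.Membership.Propositional using (_∈_)
open import Data.List.Membership.Propositional.Properties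
  using (∈-filter⁺; ∈-filter⁻; ∈-cartesianProduct⁺; ∈-allFin)
open import Data.List.Relation.Unary.All as All using (All)
import Data.List.Relation.Unary.All.Properties as All
open import Relation.Nullary using (yes; no)
open import Relation.Nullary.Decidable using (_×-dec_)
open import Relation.Unary using (Pred; Decidable)
open import Relation.Binary.Bundles using (TotalOrder)
open import Relation.Binary.Definitions using (tri<; tri≈; tri>)
open import Relation.Binary.Structures using (IsStrictTotalOrder)
import Relation.Binary.Construct.StrictToNonStrict as StrictToNonStrict
import Relation.Binary.Reasoning.PartialOrder as ≤-Reasoning
import Relation.Binary.Reasoning.Setoid as ≈-Reasoning
open import Relation.Binary.PropositionalEquality as P using (_≡_; _≢_)

module OrderedFieldProperties {c ℓ₁ ℓ₂} (F : OrderedField c ℓ₁ ℓ₂) where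
  open OrderedField F renaming (_<_ to infix 4 _<_; _≤_ to infix 4 _≤_)
  open IsStrictTotalOrder isStrictTotalOrder public using (_<?_)
  open IsStrictTotalOrder isStrictTotalOrder
    using (compare; irrefl; <-respʳ-≈; <-respˡ-≈) renaming (trans to <-trans)
  import Algebra.Properties.Ring ring as RingProperties
  open import Algebra.Solver.CommutativeMonoid *-commutativeMonoid using (solve; _⊜_; _⊕_)

  ≤-totalOrder : TotalOrder c ℓ₁ (ℓ₁ ⊔ ℓ₂)
  ≤-totalOrder = record
    { isTotalOrder = StrictToNonStrict.isTotalOrder _≈_ _<_ isStrictTotalOrder }

  open TotalOrder ≤-totalOrder public
    using (poset; ≤-respˡ-≈; ≤-respʳ-≈) renaming (refl to ≤-refl)

  <-≤-trans : ∀ {x y z} → x < y → y ≤ z → x < z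
  <-≤-trans = StrictToNonStrict.<-≤-trans _≈_ _<_ <-trans <-respʳ-≈

  neg⇒-pos : ∀ x → x < 0# → 0# < - x
  neg⇒-pos x x<0 =
    <-respʳ-≈ (+-identityˡ (- x)) (<-respˡ-≈ (-‿inverseʳ x) (+-mono-< x 0# (- x) x<0))

  -pos⇒neg : ∀ x → 0# < - x → x < 0#
  -pos⇒neg x -x>0 =
    <-respʳ-≈ (-‿inverseˡ x) (<-respˡ-≈ (+-identityˡ x) (+-mono-< 0# (- x) x -x>0))

  -- 1 is positive: 1 ≠ 0, and 1 < 0 would make 1 = (-1)(-1) positive.
  0<1 : 0# < 1#
  0<1 with compare 0# 1#
  ... | tri< 0<1 _ _ = 0<1
  ... | tri≈ _ 0≈1 _ = ⊥-elim (nontrivial 0≈1)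
  ... | tri> _ _ 1<0 = ⊥-elim (irrefl refl (<-trans 1<0 (<-respʳ-≈ square (*-pos _ _ -1>0 -1>0))))
    where
    -1>0 : 0# < - 1#
    -1>0 = neg⇒-pos 1# 1<0
    square : (- 1#) * (- 1#) ≈ 1#
    square = trans (sym (RingProperties.-‿distribˡ-* 1# (- 1#)))
                   (trans (-‿cong (*-identityˡ (- 1#))) (RingProperties.-‿involutive 1#))

  -- Multiplication by a positive element is strictly monotone, since
  -- y z = (y - x) z + x z with (y - x) z positive.
  *-monoʳ-< : ∀ {x y z} → 0# < z → x < y → x * z < y * z
  *-monoʳ-< {x} {y} {z} z>0 x<y =
    <-respʳ-≈ split (<-respˡ-≈ (+-identityˡ (x * z)) (+-mono-< 0# _ (x * z) (*-pos _ _ y-x>0 z>0)))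
    where
    y-x>0 : 0# < y + - x
    y-x>0 = <-respˡ-≈ (-‿inverseʳ x) (+-mono-< x y (- x) x<y)
    split : (y + - x) * z + x * z ≈ y * z
    split = begin
      (y + - x) * z + x * z      ≈⟨ +-congʳ (distribʳ z y (- x)) ⟩
      y * z + - x * z + x * z    ≈⟨ +-assoc (y * z) (- x * z) (x * z) ⟩
      y * z + (- x * z + x * z)  ≈⟨ +-congˡ (sym (distribʳ z (- x) x)) ⟩
      y * z + (- x + x) * z      ≈⟨ +-congˡ (trans (*-congʳ (-‿inverseˡ x)) (zeroˡ z)) ⟩
      y * z + 0#                 ≈⟨ +-identityʳ (y * z) ⟩
      y * z                      ∎
      where open ≈-Reasoning setoid

  *-monoʳ-≤ : ∀ {x y z} → 0# < z → x ≤ y → x * z ≤ y * z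
  *-monoʳ-≤ z>0 (inj₁ x<y) = inj₁ (*-monoʳ-< z>0 x<y)
  *-monoʳ-≤ _   (inj₂ x≈y) = inj₂ (*-congʳ x≈y)

  *-monoˡ-≤ : ∀ {x y z} → 0# < z → x ≤ y → z * x ≤ z * y
  *-monoˡ-≤ {x} {y} {z} z>0 x≤y =
    ≤-respˡ-≈ (*-comm x z) (≤-respʳ-≈ (*-comm y z) (*-monoʳ-≤ z>0 x≤y))

  *-cancelʳ-≤ : ∀ {x y z} → 0# < z → x * z ≤ y * z → x ≤ y
  *-cancelʳ-≤ {x} {y} z>0 xz≤yz with compare x y
  ... | tri< x<y _ _ = inj₁ x<y
  ... | tri≈ _ x≈y _ = inj₂ x≈y
  ... | tri> _ _ y<x = ⊥-elim (irrefl refl (<-≤-trans (*-monoʳ-< z>0 y<x) xz≤yz))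

  *-zeroʳ-≤ : ∀ {x y z} → 0# ≈ y → 0# ≤ z → x * y ≤ z
  *-zeroʳ-≤ {x} 0≈y 0≤z = ≤-respˡ-≈ (trans (sym (zeroʳ x)) (*-congˡ 0≈y)) 0≤z

  -- A total reciprocal: the field inverse on positive elements, 0 elsewhere.
  recip : Carrier → Carrier
  recip x with 0# <? x
  ... | yes x>0 = proj₁ (inverse x (λ x≈0 → irrefl (sym x≈0) x>0))
  ... | no _    = 0#

  recip-inverse : ∀ {x} → 0# < x → x * recip x ≈ 1#
  recip-inverse {x} x>0 with 0# <? x
  ... | yes _   = proj₂ (inverse x _)
  ... | no x≯0 = ⊥-elim (x≯0 x>0)

  -- The inverse of a positive element is positive: x (recip x) = 1 excludes
  -- recip x ≈ 0 and recip x < 0.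
  recip-pos : ∀ {x} → 0# < x → 0# < recip x
  recip-pos {x} x>0 with compare 0# (recip x)
  ... | tri< r>0 _ _ = r>0
  ... | tri≈ _ 0≈r _ =
    ⊥-elim (nontrivial (trans (sym (zeroʳ x)) (trans (*-congˡ 0≈r) (recip-inverse x>0))))
  ... | tri> _ _ r<0 = ⊥-elim (irrefl refl (<-trans 0<1 (-pos⇒neg 1# -1>0)))
    where
    -1>0 : 0# < - 1#
    -1>0 = <-respʳ-≈ (trans (sym (RingProperties.-‿distribʳ-* x (recip x))) (-‿cong (recip-inverse x>0)))
                     (*-pos _ _ x>0 (neg⇒-pos (recip x) r<0))

  recip-cancel : ∀ a {b} → 0# < b → a * recip b * b ≈ a
  recip-cancel a {b} b>0 =
    trans (solve 3 (λ a r b → (a ⊕ r) ⊕ b ⊜ a ⊕ (b ⊕ r)) refl a (recip b) b)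
          (trans (*-congˡ (recip-inverse b>0)) (*-identityʳ a))

  ≤-ratio⇒*≤ : ∀ {v a b} → 0# < b → v ≤ a * recip b → v * b ≤ a
  ≤-ratio⇒*≤ {a = a} b>0 v≤a/b = ≤-respʳ-≈ (recip-cancel a b>0) (*-monoʳ-≤ b>0 v≤a/b)

  ratio≤⇒≤* : ∀ {v a b} → 0# < b → a * recip b ≤ v → a ≤ v * b
  ratio≤⇒≤* {a = a} b>0 a/b≤v = ≤-respˡ-≈ (recip-cancel a b>0) (*-monoʳ-≤ b>0 a/b≤v)

  ratio-≤ : ∀ {a b c d} → 0# < b → 0# < d → a * d ≤ c * b → a * recip b ≤ c * recip d
  ratio-≤ {a} {b} {c} {d} b>0 d>0 ad≤cb = *-cancelʳ-≤ d>0 (*-cancelʳ-≤ b>0 (≤-respˡ-≈ lhs (≤-respʳ-≈ rhs ad≤cb)))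
    where
    lhs : a * d ≈ a * recip b * d * b
    lhs = trans (sym (recip-cancel (a * d) b>0))
                (solve 4 (λ a d r b → ((a ⊕ d) ⊕ r) ⊕ b ⊜ ((a ⊕ r) ⊕ d) ⊕ b) refl a d (recip b) b)
    rhs : c * b ≈ c * recip d * d * b
    rhs = *-congʳ (sym (recip-cancel c d>0))

module Interpolation {c ℓ₁ ℓ₂} (F : OrderedField c ℓ₁ ℓ₂) where
  open OrderedField F renaming (_<_ to infix 4 _<_; _≤_ to infix 4 _≤_)
  open OrderedFieldProperties F
  open import Data.List.Extrema ≤-totalOrder using (min; max; min≤xs; ⊥≤max; xs≤max; v≤min⁺; argmin-all)

  -- Between finitely many lower bounds and finitely many positive upper bounds,
  -- each lower bound below each upper bound, lies a positive element:
  -- v = min (max 1 L) U is either max 1 L ≥ 1 or one of the upper bounds.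
  interpolate : (L U : List Carrier) → All (0# <_) U → All (λ l → All (l ≤_) U) L →
                ∃ λ v → 0# < v × All (v ≤_) U × All (_≤ v) L
  interpolate L U U>0 L≤U = min w U , min>0 , min≤xs w U , All.map below-min (All.zip (xs≤max 1# L , L≤U))
    where
    w : Carrier
    w = max 1# L
    min>0 : 0# < min w U
    min>0 = argmin-all (λ x → x) {P = 0# <_} (<-≤-trans 0<1 (⊥≤max 1# L)) U>0
    below-min : ∀ {l} → l ≤ w × All (l ≤_) U → l ≤ min w U
    below-min (l≤w , l≤U) = v≤min⁺ l≤w l≤U

  module _ {a r} {A : Set a} (xs : List A) {R : Pred A r} (R? : Decidable R) (f : A → Carrier) where
    values : List Carrier
    values = map f (filter R? xs)

    all-values : ∀ {s} {S : Pred Carrier s} → (∀ x → R x → S (f x)) → All S values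
    all-values RS = All.map⁺ (All.tabulate λ x∈ → RS _ (proj₂ (∈-filter⁻ R? {xs = xs} x∈)))

    lookup-values : ∀ {s} {S : Pred Carrier s} → (∀ x → x ∈ xs) → All S values → ∀ x → R x → S (f x)
    lookup-values complete all x Rx = All.lookup (All.map⁻ all) (∈-filter⁺ R? (complete x) Rx)

  interpolate-indexed :
    ∀ {a p q} {A : Set a} (xs : List A) → (∀ x → x ∈ xs) →
    {Lower : Pred A p} {Upper : Pred A q} (lower? : Decidable Lower) (upper? : Decidable Upper) →
    (l u : A → Carrier) → (∀ y → Upper y → 0# < u y) → (∀ x y → Lower x → Upper y → l x ≤ u y) →
    ∃ λ v → 0# < v × (∀ y → Upper y → v ≤ u y) × (∀ x → Lower x → l x ≤ v)
  interpolate-indexed xs complete lower? upper? l u u>0 l≤u =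
    let v , v>0 , v≤U , L≤v = interpolate (values xs lower? l) (values xs upper? u)
                                (all-values xs upper? u u>0)
                                (all-values xs lower? l λ x lx → all-values xs upper? u (λ y → l≤u x y lx))
    in  v , v>0 , lookup-values xs upper? u complete v≤U , lookup-values xs lower? l complete L≤v

updateAt-all : ∀ {a p m} {A : Set a} (P : A → Set p) {α : Fin m → A} {v : A} (q : Fin m) →
               (∀ j → P (α j)) → P v → ∀ j → P (updateAt α q (λ _ → v) j)
updateAt-all P {α} q Pα Pv j with j ≟ q
... | yes P.refl = P.subst P (P.sym (updateAt-updates q α)) Pv
... | no j≢q     = P.subst P (P.sym (updateAt-minimal j q α j≢q)) (Pα j)

<-suc-≢⇒< : ∀ {m} {i q : Fin m} → toℕ i ℕ.< suc (toℕ q) → i ≢ q → toℕ i ℕ.< toℕ q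
<-suc-≢⇒< i≤q i≢q = ℕ.≤∧≢⇒< (s≤s⁻¹ i≤q) (λ i≡q → i≢q (toℕ-injective i≡q))

module RowScaling {c ℓ₁ ℓ₂} (F : OrderedField c ℓ₁ ℓ₂) {m n : ℕ}
  (M : Fin m → Fin n → OrderedField.Carrier F) (part : Fin n → Fin m)
  (nonneg : Nonneg F M) (pos : PosOffBlock F M part) (cross : CrossIneq F M part) where
  open OrderedField F renaming (_<_ to infix 4 _<_; _≤_ to infix 4 _≤_)
  open OrderedFieldProperties F
  open Interpolation F
  open import Algebra.Solver.CommutativeMonoid *-commutativeMonoid using (solve; _⊜_; _⊕_)

  Scaling : (Fin m → Carrier) → ℕ → Set (ℓ₁ ⊔ ℓ₂)
  Scaling α p = ∀ j k s → toℕ j ℕ.< p → toℕ k ℕ.< p → part s ≡ j → α j * M j s ≤ α k * M k s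

  PartialScaling : ℕ → Set (c ⊔ ℓ₁ ⊔ ℓ₂)
  PartialScaling p = ∃ λ α → (∀ j → 0# < α j) × Scaling α p

  Admissible : (Fin m → Carrier) → Fin m → Carrier → Set (ℓ₁ ⊔ ℓ₂)
  Admissible α q v = (∀ k s → toℕ k ℕ.< toℕ q → part s ≡ q → v * M q s ≤ α k * M k s)
                   × (∀ k t → toℕ k ℕ.< toℕ q → part t ≡ k → α k * M k t ≤ v * M q t)

  extend : ∀ {α q v} → Scaling α (toℕ q) → Admissible α q v →
           Scaling (updateAt α q (λ _ → v)) (suc (toℕ q))
  extend {α} {q} {v} scaled (above , below) j k s j≤q k≤q s∈j with j ≟ q | k ≟ q
  ... | yes P.refl | yes P.refl = ≤-refl
  ... | yes P.refl | no k≢q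
    rewrite updateAt-updates j {λ _ → v} α | updateAt-minimal k j {λ _ → v} α k≢q
    = above k s (<-suc-≢⇒< k≤q k≢q) s∈j
  ... | no j≢q | yes P.refl
    rewrite updateAt-updates k {λ _ → v} α | updateAt-minimal j k {λ _ → v} α j≢q
    = below j s (<-suc-≢⇒< j≤q j≢q) s∈j
  ... | no j≢q | no k≢q
    rewrite updateAt-minimal j q {λ _ → v} α j≢q | updateAt-minimal k q {λ _ → v} α k≢q
    = scaled j k s (<-suc-≢⇒< j≤q j≢q) (<-suc-≢⇒< k≤q k≢q) s∈j

  module _ {α : Fin m → Carrier} (α>0 : ∀ j → 0# < α j) {q : Fin m} (scaled : Scaling α (toℕ q)) where

    Upper : Fin m × Fin n → Set ℓ₂
    Upper (k , s) = toℕ k ℕ.< toℕ q × part s ≡ q × 0# < M q s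

    Lower : Fin m × Fin n → Set
    Lower (k , t) = toℕ k ℕ.< toℕ q × part t ≡ k

    bound : Fin m × Fin n → Carrier
    bound (k , s) = α k * M k s * recip (M q s)

    M>0-below : ∀ {k s} → toℕ k ℕ.< toℕ q → part s ≡ q → 0# < M k s
    M>0-below {k} {s} k<q s∈q = pos k s λ s∈k → ℕ.<-irrefl (P.cong toℕ (P.trans (P.sym s∈k) s∈q)) k<q

    M>0-row-q : ∀ {k t} → toℕ k ℕ.< toℕ q → part t ≡ k → 0# < M q t
    M>0-row-q {k} {t} k<q t∈k = pos q t λ t∈q → ℕ.<-irrefl (P.cong toℕ (P.trans (P.sym t∈k) t∈q)) k<q

    upper>0 : ∀ y → Upper y → 0# < bound y
    upper>0 (k , s) (k<q , s∈q , Mqs>0) = *-pos _ _ (*-pos _ _ (α>0 k) (M>0-below k<q s∈q)) (recip-pos Mqs>0)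

    -- For t ∈ S_k, s ∈ S_q and k, k' < q, the scaling on the earlier rows and
    -- the cross inequality give
    --   α_k M_{k,t} M_{q,s} ≤ α_k' M_{k',t} M_{q,s} ≤ α_k' M_{k',s} M_{q,t};
    -- dividing by M_{q,t} M_{q,s} gives the claim.
    lower≤upper : ∀ x y → Lower x → Upper y → bound x ≤ bound y
    lower≤upper (k , t) (k' , s) (k<q , t∈k) (k'<q , s∈q , Mqs>0) =
      ratio-≤ (M>0-row-q k<q t∈k) Mqs>0 (begin
        α k * M k t * M q s        ≤⟨ *-monoʳ-≤ Mqs>0 (scaled k k' t k<q k'<q t∈k) ⟩
        α k' * M k' t * M q s      ≈⟨ solve 3 (λ a x y → (a ⊕ x) ⊕ y ⊜ a ⊕ (y ⊕ x)) refl (α k') (M k' t) (M q s) ⟩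
        α k' * (M q s * M k' t)    ≤⟨ *-monoˡ-≤ (α>0 k') (cross q k' s t k'<q s∈q t<q) ⟩
        α k' * (M q t * M k' s)    ≈⟨ solve 3 (λ a x y → a ⊕ (y ⊕ x) ⊜ (a ⊕ x) ⊕ y) refl (α k') (M k' s) (M q t) ⟩
        α k' * M k' s * M q t      ∎)
      where
      open ≤-Reasoning poset
      t<q : toℕ (part t) ℕ.< toℕ q
      t<q = P.subst (λ i → toℕ i ℕ.< toℕ q) (P.sym t∈k) k<q

    admissible-exists : ∃ λ v → 0# < v × Admissible α q v
    admissible-exists =
      let v , v>0 , v≤upper , lower≤v = interpolate-indexed pairs complete lower? upper? bound bound upper>0 lower≤upper
      in  v , v>0 , above v≤upper , below lower≤v
      where
      pairs : List (Fin m × Fin n)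
      pairs = cartesianProduct (allFin m) (allFin n)

      complete : ∀ x → x ∈ pairs
      complete (k , s) = ∈-cartesianProduct⁺ (∈-allFin k) (∈-allFin s)

      upper? : Decidable Upper
      upper? (k , s) = (toℕ k ℕ.<? toℕ q) ×-dec ((part s ≟ q) ×-dec (0# <? M q s))

      lower? : Decidable Lower
      lower? (k , t) = (toℕ k ℕ.<? toℕ q) ×-dec (part t ≟ k)

      -- Columns with M_{q,s} = 0 impose no upper bound.
      above : ∀ {v} → (∀ y → Upper y → v ≤ bound y) →
              ∀ k s → toℕ k ℕ.< toℕ q → part s ≡ q → v * M q s ≤ α k * M k s
      above v≤upper k s k<q s∈q with nonneg q s
      ... | inj₁ Mqs>0 = ≤-ratio⇒*≤ Mqs>0 (v≤upper (k , s) (k<q , s∈q , Mqs>0))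
      ... | inj₂ 0≈Mqs = *-zeroʳ-≤ 0≈Mqs (inj₁ (*-pos _ _ (α>0 k) (M>0-below k<q s∈q)))

      below : ∀ {v} → (∀ x → Lower x → bound x ≤ v) →
              ∀ k t → toℕ k ℕ.< toℕ q → part t ≡ k → α k * M k t ≤ v * M q t
      below lower≤v k t k<q t∈k = ratio≤⇒≤* (M>0-row-q k<q t∈k) (lower≤v (k , t) (k<q , t∈k))

  step : ∀ q → PartialScaling (toℕ q) → PartialScaling (suc (toℕ q))
  step q (α , α>0 , scaled) =
    let v , v>0 , admissible = admissible-exists α>0 scaled
    in  updateAt α q (λ _ → v) , updateAt-all (0# <_) q α>0 v>0 , extend scaled admissible

  partial-scaling : ∀ p → p ℕ.≤ m → PartialScaling p
  partial-scaling zero    _   = (λ _ → 1#) , (λ _ → 0<1) , λ _ _ _ ()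
  partial-scaling (suc p) p<m =
    P.subst (λ i → PartialScaling (suc i)) (toℕ-fromℕ< p<m)
      (step q (P.subst PartialScaling (P.sym (toℕ-fromℕ< p<m)) (partial-scaling p (ℕ.<⇒≤ p<m))))
    where
    q : Fin m
    q = fromℕ< p<m

lemma10p3 : ∀ {c ℓ₁ ℓ₂} (F : OrderedField c ℓ₁ ℓ₂) (m n : ℕ)
            (M : Fin m → Fin n → OrderedField.Carrier F) (part : Fin n → Fin m) →
            Nonneg F M → BlocksNonempty F part → PosOffBlock F M part → CrossIneq F M part →
            ∃ λ (α : Fin m → OrderedField.Carrier F) →
              (∀ j → OrderedField._<_ F (OrderedField.0# F) (α j)) ×
              (∀ j k s → part s ≡ j →
                OrderedField._≤_ F (OrderedField._*_ F (α j) (M j s)) (OrderedField._*_ F (α k) (M k s)))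
lemma10p3 F m n M part nonneg _ pos cross =
  let α , α>0 , scaled = partial-scaling m ℕ.≤-refl
  in  α , α>0 , λ j k s s∈j → scaled j k s (toℕ<n j) (toℕ<n k) s∈j
  where open RowScaling F M part nonneg pos cross
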